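{- Let $n>3$ be an odd positive integer and let $i,j\in\{0,\dots,n-1\}$ with $i<j$. Then $\{i,j\}$ is a dominating pair in $\Delta_n$ if and only if $j=n-1$.
   Context: For odd $n$, the tournament $\Delta_n$ on vertex set $\{0,\dots,n-1\}$ is defined recursively: $\Delta_1$ is a single vertex $0$; for $n>1$, the subtournament induced on $\{0,\dots,n-3\}$ is $\Delta_{n-2}$, every vertex $v\in\{0,\dots,n-3\}$ satisfies $(n-1)\to v$ and $v\to(n-2)$, and $(n-2)\to(n-1)$. A set $\{v,w\}$ of two vertices is a dominating pair in a tournament if every vertex other than $v,w$ is dominated by (i.e. has an edge from) $v$ or $w$. (In the paper's usage, a dominating set $S$ requires every vertex $u$ to be in $S$ or to have an edge from some vertex of $S$.) -}

module Defs where

open import Data.Nat using (ℕ; zero; suc; _+_; _*_; _<_)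
open import Relation.Binary.PropositionalEquality using (_≢_)
open import Data.Sum using (_⊎_)

-- Δ k  denotes the tournament Δ_n with n = 2k+1, on vertex set {0,…,2k}.
-- Arc k u v  :  u → v in Δ_{2k+1}.
data Arc : ℕ → ℕ → ℕ → Set where
  -- the subtournament on {0,…,n-3} is Δ_{n-2}
  old  : ∀ {k u v} → Arc k u v → Arc (suc k) u v
  top→ : ∀ {k v} → v < 2 * k + 1 → Arc (suc k) (2 * k + 2) v
  →mid : ∀ {k v} → v < 2 * k + 1 → Arc (suc k) v (2 * k + 1)
  mid→top : ∀ {k} → Arc (suc k) (2 * k + 1) (2 * k + 2)

size : ℕ → ℕ
size k = 2 * k + 1

DominatingPair : ℕ → ℕ → ℕ → Set
DominatingPair k v w = ∀ u → u < size k → u ≢ v → u ≢ w → Arc k v u ⊎ Arc k w u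

{-# OPTIONS --safe #-}
module Submission where

-- Δ_{n+2} is Δ_n together with a middle vertex n and a top vertex n+1, where
-- top → Δ_n → middle → top. The only in-neighbour of the top vertex is the
-- middle one, and the only out-neighbour of the middle vertex is the top one.
-- Hence a dominating pair must contain the middle or the top vertex. If it is
-- the top one, it covers Δ_n and the other vertex covers the middle one. If it
-- is the middle one paired with a vertex i of Δ_n, then the in-neighbour of i
-- inside Δ_n (which exists once n ≥ 3) is dominated neither by i (a tournament
-- is asymmetric) nor by the middle vertex.

open import Defs
open import Data.Nat using (ℕ; zero; suc; _+_; _*_; _<_; _≤_; s≤s; z<s)
open import Data.Nat.Properties
  using (<-irrefl; <-trans; <-cmp; <⇒≢; ≤-antisym; ≤∧≢⇒<; m<1+n⇒m≤n; m<m+n; n<1+n; +-monoʳ-<; +-suc; +-comm; *-suc)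
open import Data.Product using (_×_; _,_; ∃-syntax)
open import Data.Sum using (inj₁; inj₂; [_,_]′)
open import Data.Empty using (⊥-elim)
open import Function using (_∘_)
open import Relation.Binary using (tri<; tri≈; tri>)
open import Relation.Binary.PropositionalEquality using (_≡_; _≢_; refl; sym; trans; cong; subst)
open import Relation.Nullary using (¬_)

twice-suc : ∀ k → 2 * suc k ≡ 2 * k + 2
twice-suc k = trans (*-suc 2 k) (+-comm 2 (2 * k))

size-suc : ∀ k → size (suc k) ≡ suc (2 * k + 2)
size-suc k = trans (cong (_+ 1) (twice-suc k)) (+-comm (2 * k + 2) 1)

mid<top : ∀ k → 2 * k + 1 < 2 * k + 2
mid<top k = +-monoʳ-< (2 * k) (n<1+n 1)

old≢mid : ∀ k {v} → v < size k → v ≢ 2 * k + 1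
old≢mid _ v<size v≡mid = <-irrefl v≡mid v<size

old≢top : ∀ k {v} → v < size k → v ≢ 2 * k + 2
old≢top k v<size v≡top = <-irrefl v≡top (<-trans v<size (mid<top k))

data Vertex (k : ℕ) : ℕ → Set where
  old : ∀ {v} → v < size k → Vertex k v
  mid : Vertex k (2 * k + 1)
  top : Vertex k (2 * k + 2)

top<size-suc : ∀ k → 2 * k + 2 < size (suc k)
top<size-suc k = subst (2 * k + 2 <_) (sym (size-suc k)) (n<1+n _)

Vertex⇒< : ∀ k {v} → Vertex k v → v < size (suc k)
Vertex⇒< k top          = top<size-suc k
Vertex⇒< k mid          = <-trans (mid<top k) (top<size-suc k)
Vertex⇒< k (old v<size) = <-trans v<size (<-trans (mid<top k) (top<size-suc k))

classify : ∀ k {v} → v < size (suc k) → Vertex k v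
classify k {v} v<size with <-cmp v (2 * k + 1)
... | tri< v<mid _ _ = old v<mid
... | tri≈ _ refl _  = mid
... | tri> _ _ mid<v = subst (Vertex k) (sym v≡top) top
  where
    v≡top : v ≡ 2 * k + 2
    v≡top = ≤-antisym (m<1+n⇒m≤n (subst (v <_) (size-suc k) v<size))
                      (subst (_≤ v) (sym (+-suc (2 * k) 1)) mid<v)

arc-source-< : ∀ {k u v} → Arc k u v → u < size k
arc-source-< {suc k} (old a)       = Vertex⇒< k (old (arc-source-< a))
arc-source-< {suc k} (top→ _)      = Vertex⇒< k top
arc-source-< {suc k} (→mid u<size) = Vertex⇒< k (old u<size)
arc-source-< {suc k} mid→top       = Vertex⇒< k mid

arc-target-< : ∀ {k u v} → Arc k u v → v < size k
arc-target-< {suc k} (old a)       = Vertex⇒< k (old (arc-target-< a))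
arc-target-< {suc k} (top→ v<size) = Vertex⇒< k (old v<size)
arc-target-< {suc k} (→mid _)      = Vertex⇒< k mid
arc-target-< {suc k} mid→top       = Vertex⇒< k top

arc-into-top : ∀ {k u v} → Arc (suc k) u v → v ≡ 2 * k + 2 → u ≡ 2 * k + 1
arc-into-top {k} (old a)       refl    = ⊥-elim (old≢top k (arc-target-< a) refl)
arc-into-top {k} (top→ v<size) refl    = ⊥-elim (old≢top k v<size refl)
arc-into-top {k} (→mid _)      mid≡top = ⊥-elim (<⇒≢ (mid<top k) mid≡top)
arc-into-top     mid→top       _       = refl

arc-from-mid : ∀ {k u v} → Arc (suc k) u v → u ≡ 2 * k + 1 → v ≡ 2 * k + 2
arc-from-mid {k} (old a)       refl    = ⊥-elim (old≢mid k (arc-source-< a) refl)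
arc-from-mid {k} (top→ _)      top≡mid = ⊥-elim (<⇒≢ (mid<top k) (sym top≡mid))
arc-from-mid {k} (→mid u<size) refl    = ⊥-elim (old≢mid k u<size refl)
arc-from-mid     mid→top       _       = refl

arc-from-top : ∀ {k u v} → Arc (suc k) u v → u ≡ 2 * k + 2 → v < size k
arc-from-top {k} (old a)       refl    = ⊥-elim (old≢top k (arc-source-< a) refl)
arc-from-top     (top→ v<size) _       = v<size
arc-from-top {k} (→mid u<size) refl    = ⊥-elim (old≢top k u<size refl)
arc-from-top {k} mid→top       mid≡top = ⊥-elim (<⇒≢ (mid<top k) mid≡top)

arc-restrict : ∀ {k u v} → Arc (suc k) u v → u < size k → v < size k → Arc k u v
arc-restrict     (old a)  _      _      = a
arc-restrict {k} (top→ _) u<size _      = ⊥-elim (old≢top k u<size refl)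
arc-restrict {k} (→mid _) _      v<size = ⊥-elim (old≢mid k v<size refl)
arc-restrict {k} mid→top  u<size _      = ⊥-elim (old≢mid k u<size refl)

arc-asym : ∀ {k u v} → Arc k u v → ¬ Arc k v u
arc-asym         (old a)       b = arc-asym a (arc-restrict b (arc-target-< a) (arc-source-< a))
arc-asym {suc k} (top→ v<size) b = old≢mid k v<size (arc-into-top b refl)
arc-asym {suc k} (→mid u<size) b = old≢top k u<size (arc-from-mid b refl)
arc-asym {suc k} mid→top       b = old≢mid k (arc-from-top b refl) refl

arc-irrefl : ∀ {k v} → ¬ Arc k v v
arc-irrefl a = arc-asym a a

has-in-neighbour : ∀ k {v} → v < size (suc k) → ∃[ u ] Arc (suc k) u v
has-in-neighbour k v<size with classify k v<size
... | old v<mid = 2 * k + 2 , top→ v<mid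
... | mid       = 2 * k , →mid (m<m+n (2 * k) z<s)
... | top       = 2 * k + 1 , mid→top

top-dominatingPair : ∀ k {i} → i < 2 * k + 2 → DominatingPair (suc k) i (2 * k + 2)
top-dominatingPair k {i} i<top u u<size u≢i u≢top with classify k u<size
... | old u<mid = inj₂ (top→ u<mid)
... | top       = ⊥-elim (u≢top refl)
... | mid       = inj₁ (→mid (≤∧≢⇒< (m<1+n⇒m≤n i<1+mid) (u≢i ∘ sym)))
  where
    i<1+mid : i < suc (2 * k + 1)
    i<1+mid = subst (i <_) (+-suc (2 * k) 1) i<top

old-mid-¬dominatingPair : ∀ k {i} → i < size (suc k) → ¬ DominatingPair (suc (suc k)) i (2 * suc k + 1)
old-mid-¬dominatingPair k {i} i<size dom with has-in-neighbour k i<size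
... | u , u→i = [ i↛u , mid↛u ]′
                  (dom u (Vertex⇒< (suc k) (old u<size)) u≢i (old≢mid (suc k) u<size))
  where
    u<size : u < size (suc k)
    u<size = arc-source-< u→i
    u≢i : u ≢ i
    u≢i refl = arc-irrefl u→i
    i↛u : ¬ Arc (suc (suc k)) i u
    i↛u i→u = arc-asym u→i (arc-restrict i→u i<size u<size)
    mid↛u : ¬ Arc (suc (suc k)) (2 * suc k + 1) u
    mid↛u mid→u = old≢top (suc k) u<size (arc-from-mid mid→u refl)

dominatingPair⇒≡top : ∀ k {i j} → i < j → j < size (suc (suc k)) →
                      DominatingPair (suc (suc k)) i j → j ≡ 2 * suc k + 2
dominatingPair⇒≡top k {i} {j} i<j j<size dom with classify (suc k) j<size
... | top         = refl
... | mid         = ⊥-elim (old-mid-¬dominatingPair k i<j dom)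
... | old j<size′ = ⊥-elim ([ ↛top i<size′ , ↛top j<size′ ]′
                              (dom (2 * suc k + 2) (Vertex⇒< (suc k) top)
                                   (old≢top (suc k) i<size′ ∘ sym) (old≢top (suc k) j<size′ ∘ sym)))
  where
    i<size′ : i < size (suc k)
    i<size′ = <-trans i<j j<size′
    ↛top : ∀ {v} → v < size (suc k) → ¬ Arc (suc (suc k)) v (2 * suc k + 2)
    ↛top v<size′ v→top = old≢mid (suc k) v<size′ (arc-into-top v→top refl)

lemma4p1 : (k : ℕ) → 3 < 2 * k + 1 → (i j : ℕ) → i < j → j < 2 * k + 1 →
    (DominatingPair k i j → j ≡ 2 * k) × (j ≡ 2 * k → DominatingPair k i j)
lemma4p1 zero          (s≤s ())             _ _ _   _
lemma4p1 (suc zero)    (s≤s (s≤s (s≤s ()))) _ _ _   _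
lemma4p1 (suc (suc k)) _                    i j i<j j<size = forward , backward
  where
    forward : DominatingPair (suc (suc k)) i j → j ≡ 2 * suc (suc k)
    forward dom = trans (dominatingPair⇒≡top k i<j j<size dom) (sym (twice-suc (suc k)))
    backward : j ≡ 2 * suc (suc k) → DominatingPair (suc (suc k)) i j
    backward j≡top = subst (DominatingPair (suc (suc k)) i) (sym j≡top′)
                           (top-dominatingPair (suc k) (subst (i <_) j≡top′ i<j))
      where
        j≡top′ : j ≡ 2 * suc k + 2
        j≡top′ = trans j≡top (twice-suc (suc k))
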